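{- Let $n\geq 2$ and $1\le k\leq \lfloor \frac{n}{2} \rfloor$, and let $K_n$ be the complete graph on $n$ vertices. Then $\alpha(T_k(K_n)) = \frac{1}{k}\binom{n}{k-1}$ if and only if there exists a $t$-$(n,k,1)$ design with $t=k-1$.
   Context: For a graph $G$ with vertex set $V$ of size $n$ and $1\le k\le n-1$, the $k$-token graph $T_k(G)$ has as vertices the $k$-subsets of $V$, two of them adjacent if their symmetric difference is an edge of $G$. $\alpha(\Gamma)$ denotes the independence number of a graph $\Gamma$. A $t$-$(v,k,\lambda)$ design is a collection of $k$-subsets of a $v$-element set such that every $t$-subset is contained in exactly $\lambda$ of these $k$-subsets. -}

module Defs where

open import Data.Nat using (ℕ; _≤_)
open import Data.Fin using (Fin)
open import Data.Fin.Subset using (Subset; ∣_∣; _∪_; _─_; ⁅_⁆)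
open import Data.Fin.Subset.Properties using (_⊆?_)
open import Data.Product using (Σ; Σ-syntax; ∃-syntax; _×_)
open import Data.List using (List; length; filter)
open import Data.List.Relation.Unary.All using (All)
open import Data.List.Relation.Unary.AllPairs using (AllPairs)
open import Data.List.Relation.Unary.Unique.Propositional using (Unique)
open import Relation.Binary.PropositionalEquality using (_≡_; _≢_)
open import Relation.Nullary using (¬_)

record Graph : Set₁ where
  field
    V   : Set
    Adj : V → V → Set
open Graph public

FinGraph : ℕ → Set₁
FinGraph n = Fin n → Fin n → Set

Kₙ : (n : ℕ) → FinGraph n
Kₙ n u v = u ≢ v

_△_ : ∀ {n} → Subset n → Subset n → Subset n
A △ B = (A ─ B) ∪ (B ─ A)

TokenGraph : ∀ {n} → ℕ → FinGraph n → Graph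
TokenGraph {n} k E = record
  { V   = Σ[ A ∈ Subset n ] ∣ A ∣ ≡ k
  ; Adj = λ A B → ∃[ u ] ∃[ v ] (E u v × (Σ.proj₁ A △ Σ.proj₁ B ≡ ⁅ u ⁆ ∪ ⁅ v ⁆))
  }

IsIndependent : (Γ : Graph) → List (V Γ) → Set
IsIndependent Γ S =
  Unique S × AllPairs (λ x y → ¬ Adj Γ x y × ¬ Adj Γ y x) S

IsIndependenceNumber : Graph → ℕ → Set
IsIndependenceNumber Γ a =
  (∃[ S ] (IsIndependent Γ S × length S ≡ a)) ×
  (∀ S → IsIndependent Γ S → length S ≤ a)

IsDesign : (t v k λ' : ℕ) → List (Subset v) → Set
IsDesign t v k λ' B =
  All (λ b → ∣ b ∣ ≡ k) B ×
  (∀ (T : Subset v) → ∣ T ∣ ≡ t → length (filter (λ b → T ⊆? b) B) ≡ λ')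

-- A vertex of T_k(K_n) is a k-set, and with j = k - 1 two k-sets are adjacent exactly when
-- they meet in j points.  Hence two distinct k-sets are non-adjacent iff they share no
-- j-subset, so an independent set is a family of k-sets in which every j-set lies in at most
-- one member (a packing).  Double counting the pairs (j-set, block containing it) gives
-- k·|S| ≤ C(n, j) for every packing S, with equality iff every j-set lies in exactly one
-- block, i.e. iff S is a j-(n, k, 1) design.
module Submission where

open import Defs
open import Data.Nat using (ℕ; _≤_; _*_; _∸_; _/_)
open import Data.Nat.Combinatorics using (_C_)
open import Data.Product using (∃-syntax)
open import Function.Bundles using (_⇔_)
open import Relation.Binary.PropositionalEquality using (_≡_)

open import Data.Nat using (zero; suc; _+_; z≤n; s≤s)
open import Data.Nat.Properties
open import Data.Nat.Combinatorics using (nCk+nC[k+1]≡[n+1]C[k+1]; nCk≡nC[n∸k]; nC1≡n)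
open import Data.Nat.ListAction using (sum)
open import Algebra.Properties.CommutativeSemigroup +-commutativeSemigroup using (interchange)
open import Data.Bool using (true; false; if_then_else_)
open import Data.Product using (_×_; _,_; proj₁; swap)
open import Data.Sum using (_⊎_; inj₁; inj₂)
open import Data.List using (List; []; _∷_; [_]; _++_; map; length; filter)
open import Data.List.Properties using (length-++; length-map; map-cong; filter-++; filter-none; filter-all)
open import Data.List.Membership.Propositional using (_∈_)
open import Data.List.Membership.Propositional.Properties using (∈-map⁺; ∈-++⁺ˡ; ∈-++⁺ʳ)
open import Data.List.Relation.Unary.Any using (here)
open import Data.List.Relation.Unary.All as All using (All; []; _∷_)
open import Data.List.Relation.Unary.All.Properties using (++⁺) renaming (map⁺ to All-map⁺; map⁻ to All-map⁻)
open import Data.List.Relation.Unary.AllPairs as AllPairs using (AllPairs; []; _∷_)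
import Data.List.Relation.Unary.AllPairs.Properties as AllPairs
open import Data.Fin using (Fin; zero; suc)
import Data.Fin.Properties as Fin
import Data.Vec as Vec
open import Data.Vec using ([]; _∷_)
open import Data.Fin.Subset using (Subset; inside; outside; ∣_∣; _∩_; _∪_; ⁅_⁆; _⊆_; ⊤; ⊥)
open import Data.Fin.Subset.Properties
  using ( _⊆?_; ⊆⊤; ⊥⊆; out⊆; in⊆in; ∣⊤∣≡n; ∣⊥∣≡0; ∣⁅x⁆∣≡1; ∪-identityˡ; ∪-identityʳ
        ; p∩q⊆p; p∩q⊆q; x∈p∩q⁺; ∣p∩q∣≤∣p∣; p⊆q⇒∣p∣≤∣q∣ )
open import Function using (_∘_)
open import Function.Bundles using (mk⇔; Equivalence)
open import Function.Properties.Equivalence using () renaming (trans to ⇔-trans; sym to ⇔-sym)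
open import Relation.Binary.PropositionalEquality
  using (_≢_; refl; sym; trans; cong; cong₂; subst; subst₂; module ≡-Reasoning)
open import Relation.Nullary using (¬_; Dec; does; yes; no; contradiction)
open import Relation.Unary using (Decidable; ∁)

private
  variable
    A B : Set
    n m : ℕ
    P : A → Set

count : {P : A → Set} → Decidable P → List A → ℕ
count P? xs = length (filter P? xs)

count-∷ : (P? : Decidable P) (x : A) (xs : List A) →
          count P? (x ∷ xs) ≡ (if does (P? x) then 1 else 0) + count P? xs
count-∷ P? x xs with does (P? x)
... | true  = refl
... | false = refl

count-++ : (P? : Decidable P) (xs ys : List A) → count P? (xs ++ ys) ≡ count P? xs + count P? ys
count-++ P? xs ys = trans (cong length (filter-++ P? xs ys)) (length-++ (filter P? xs))

count-map : {Q : B → Set} (P? : Decidable P) (Q? : Decidable Q) (f : A → B) →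
            (∀ x → does (Q? (f x)) ≡ does (P? x)) →
            ∀ xs → count Q? (map f xs) ≡ count P? xs
count-map P? Q? f same []       = refl
count-map P? Q? f same (x ∷ xs) = begin
  count Q? (f x ∷ map f xs)                               ≡⟨ count-∷ Q? (f x) (map f xs) ⟩
  (if does (Q? (f x)) then 1 else 0) + count Q? (map f xs) ≡⟨ cong₂ (λ b c → (if b then 1 else 0) + c)
                                                                     (same x) (count-map P? Q? f same xs) ⟩
  (if does (P? x) then 1 else 0) + count P? xs             ≡⟨ count-∷ P? x xs ⟨
  count P? (x ∷ xs)                                        ∎
  where open ≡-Reasoning

count≡0⇒All∁ : (P? : Decidable P) (xs : List A) → count P? xs ≡ 0 → All (∁ P) xs
count≡0⇒All∁ P? []       _ = []
count≡0⇒All∁ P? (x ∷ xs) h with P? x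
... | no ¬px = ¬px ∷ count≡0⇒All∁ P? xs h

count≤1⇔AllPairs : (P? : Decidable P) (xs : List A) →
                   count P? xs ≤ 1 ⇔ AllPairs (λ x y → ¬ (P x × P y)) xs
count≤1⇔AllPairs {P = P} P? xs = mk⇔ (to xs) (from xs)
  where
  to : ∀ xs → count P? xs ≤ 1 → AllPairs (λ x y → ¬ (P x × P y)) xs
  to []       _ = []
  to (x ∷ xs) h with P? x
  ... | yes px = All.map (λ ¬py (_ , py) → ¬py py) (count≡0⇒All∁ P? xs (n≤0⇒n≡0 (≤-pred h)))
               ∷ to xs (≤-trans (n≤1+n _) h)
  ... | no ¬px = All.universal (λ _ (px , _) → ¬px px) xs ∷ to xs h
  from : ∀ xs → AllPairs (λ x y → ¬ (P x × P y)) xs → count P? xs ≤ 1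
  from []       _ = z≤n
  from (x ∷ xs) (apart ∷ rest) with P? x
  ... | yes px = s≤s (≤-reflexive (cong length (filter-none P? (All.map (λ ¬both → ¬both ∘ (px ,_)) apart))))
  ... | no _   = from xs rest

AllPairs-∀⇔ : {I : Set} {Q : I → Set} {R : I → A → A → Set} (xs : List A) →
              (∀ i → Q i → AllPairs (R i) xs) ⇔ AllPairs (λ x y → ∀ i → Q i → R i x y) xs
AllPairs-∀⇔ {Q = Q} {R} xs = mk⇔ (to xs) (λ h i qi → AllPairs.map (λ r → r i qi) h)
  where
  to : ∀ xs → (∀ i → Q i → AllPairs (R i) xs) → AllPairs (λ x y → ∀ i → Q i → R i x y) xs
  to []       _ = []
  to (x ∷ xs) h = All.tabulate (λ y∈xs i qi → All.lookup (AllPairs.head (h i qi)) y∈xs)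
                ∷ to xs (λ i qi → AllPairs.tail (h i qi))

sum-map-+ : (f g : A → ℕ) (xs : List A) →
            sum (map (λ x → f x + g x) xs) ≡ sum (map f xs) + sum (map g xs)
sum-map-+ f g []       = refl
sum-map-+ f g (x ∷ xs) = trans (cong (f x + g x +_) (sum-map-+ f g xs))
                               (interchange (f x) (g x) (sum (map f xs)) (sum (map g xs)))

sum-map-const : (f : A → ℕ) {c : ℕ} {xs : List A} → All (λ x → f x ≡ c) xs →
                sum (map f xs) ≡ length xs * c
sum-map-const f []         = refl
sum-map-const f (fx≡c ∷ h) = cong₂ _+_ fx≡c (sum-map-const f h)

sum-map-indicator : (P? : Decidable P) (xs : List A) →
                    sum (map (λ x → if does (P? x) then 1 else 0) xs) ≡ count P? xs
sum-map-indicator P? []       = refl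
sum-map-indicator P? (x ∷ xs) = trans (cong (_ +_) (sum-map-indicator P? xs)) (sym (count-∷ P? x xs))

sum-count-comm : {R : A → B → Set} (R? : ∀ x y → Dec (R x y)) (xs : List A) (ys : List B) →
                 sum (map (λ x → count (R? x) ys) xs) ≡ sum (map (λ y → count (λ x → R? x y) xs) ys)
sum-count-comm R? xs []       =
  trans (sum-map-const (λ _ → 0) (All.universal (λ _ → refl) xs)) (*-zeroʳ (length xs))
sum-count-comm R? xs (y ∷ ys) = begin
  sum (map (λ x → count (R? x) (y ∷ ys)) xs)
    ≡⟨ cong sum (map-cong (λ x → count-∷ (R? x) y ys) xs) ⟩
  sum (map (λ x → (if does (R? x y) then 1 else 0) + count (R? x) ys) xs)
    ≡⟨ sum-map-+ _ _ xs ⟩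
  sum (map (λ x → if does (R? x y) then 1 else 0) xs) + sum (map (λ x → count (R? x) ys) xs)
    ≡⟨ cong₂ _+_ (sum-map-indicator (λ x → R? x y) xs) (sum-count-comm R? xs ys) ⟩
  count (λ x → R? x y) xs + sum (map (λ y → count (λ x → R? x y) xs) ys)
    ∎
  where open ≡-Reasoning

sum≤length : {ns : List ℕ} → All (_≤ 1) ns → sum ns ≤ length ns
sum≤length []        = z≤n
sum≤length (n≤1 ∷ h) = +-mono-≤ n≤1 (sum≤length h)

sum≡length⇔All≡1 : {ns : List ℕ} → All (_≤ 1) ns → sum ns ≡ length ns ⇔ All (_≡ 1) ns
sum≡length⇔All≡1 h = mk⇔ (to h) from
  where
  to : ∀ {ns} → All (_≤ 1) ns → sum ns ≡ length ns → All (_≡ 1) ns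
  to []                _ = []
  to {_ ∷ ns} (z≤n ∷ h) eq = contradiction (subst (_≤ length ns) eq (sum≤length h)) 1+n≰n
  to (s≤s z≤n ∷ h) eq = refl ∷ to h (suc-injective eq)
  from : ∀ {ns} → All (_≡ 1) ns → sum ns ≡ length ns
  from []          = refl
  from (refl ∷ h) = cong suc (from h)

subsetsOfSize : (n m : ℕ) → List (Subset n)
subsetsOfSize zero    zero    = [ [] ]
subsetsOfSize zero    (suc m) = []
subsetsOfSize (suc n) zero    = map (outside ∷_) (subsetsOfSize n zero)
subsetsOfSize (suc n) (suc m) =
  map (outside ∷_) (subsetsOfSize n (suc m)) ++ map (inside ∷_) (subsetsOfSize n m)

subsetsOfSize-sized : ∀ n m → All (λ q → ∣ q ∣ ≡ m) (subsetsOfSize n m)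
subsetsOfSize-sized zero    zero    = refl ∷ []
subsetsOfSize-sized zero    (suc m) = []
subsetsOfSize-sized (suc n) zero    = All-map⁺ (subsetsOfSize-sized n zero)
subsetsOfSize-sized (suc n) (suc m) =
  ++⁺ (All-map⁺ (subsetsOfSize-sized n (suc m))) (All-map⁺ (All.map (cong suc) (subsetsOfSize-sized n m)))

∈-subsetsOfSize : (p : Subset n) → p ∈ subsetsOfSize n ∣ p ∣
∈-subsetsOfSize []            = here refl
∈-subsetsOfSize (inside  ∷ p) = ∈-++⁺ʳ (map (outside ∷_) _) (∈-map⁺ (inside ∷_) (∈-subsetsOfSize p))
∈-subsetsOfSize (outside ∷ p) with ∣ p ∣ | ∈-subsetsOfSize p
... | zero  | p∈ = ∈-map⁺ (outside ∷_) p∈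
... | suc m | p∈ = ∈-++⁺ˡ (∈-map⁺ (outside ∷_) p∈)

count-⊆-subsetsOfSize : (p : Subset n) (m : ℕ) → count (_⊆? p) (subsetsOfSize n m) ≡ ∣ p ∣ C m
count-⊆-subsetsOfSize []      zero    = refl
count-⊆-subsetsOfSize []      (suc m) = refl
count-⊆-subsetsOfSize {suc n} (x ∷ p) zero =
  trans (count-map (_⊆? p) (_⊆? x ∷ p) (outside ∷_) (λ _ → refl) (subsetsOfSize n zero))
        (count-⊆-subsetsOfSize p zero)
count-⊆-subsetsOfSize {suc n} (inside ∷ p) (suc m) = begin
  count (_⊆? inside ∷ p) (map (outside ∷_) L₁ ++ map (inside ∷_) L₀)
    ≡⟨ count-++ (_⊆? inside ∷ p) (map (outside ∷_) L₁) (map (inside ∷_) L₀) ⟩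
  count (_⊆? inside ∷ p) (map (outside ∷_) L₁) + count (_⊆? inside ∷ p) (map (inside ∷_) L₀)
    ≡⟨ cong₂ _+_ (count-map (_⊆? p) (_⊆? inside ∷ p) (outside ∷_) (λ _ → refl) L₁)
                 (count-map (_⊆? p) (_⊆? inside ∷ p) (inside ∷_) (λ _ → refl) L₀) ⟩
  count (_⊆? p) L₁ + count (_⊆? p) L₀
    ≡⟨ cong₂ _+_ (count-⊆-subsetsOfSize p (suc m)) (count-⊆-subsetsOfSize p m) ⟩
  ∣ p ∣ C suc m + ∣ p ∣ C m
    ≡⟨ +-comm (∣ p ∣ C suc m) _ ⟩
  ∣ p ∣ C m + ∣ p ∣ C suc m
    ≡⟨ nCk+nC[k+1]≡[n+1]C[k+1] ∣ p ∣ m ⟩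
  suc ∣ p ∣ C suc m
    ∎
  where
  open ≡-Reasoning
  L₁ = subsetsOfSize n (suc m)
  L₀ = subsetsOfSize n m
count-⊆-subsetsOfSize {suc n} (outside ∷ p) (suc m) = begin
  count (_⊆? outside ∷ p) (map (outside ∷_) L₁ ++ map (inside ∷_) L₀)
    ≡⟨ count-++ (_⊆? outside ∷ p) (map (outside ∷_) L₁) (map (inside ∷_) L₀) ⟩
  count (_⊆? outside ∷ p) (map (outside ∷_) L₁) + count (_⊆? outside ∷ p) (map (inside ∷_) L₀)
    ≡⟨ cong₂ _+_ (count-map (_⊆? p) (_⊆? outside ∷ p) (outside ∷_) (λ _ → refl) L₁)
                 (cong length (filter-none (_⊆? outside ∷ p) (All-map⁺ (All.universal inside⊈outside L₀)))) ⟩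
  count (_⊆? p) L₁ + 0
    ≡⟨ +-identityʳ _ ⟩
  count (_⊆? p) L₁
    ≡⟨ count-⊆-subsetsOfSize p (suc m) ⟩
  ∣ p ∣ C suc m
    ∎
  where
  open ≡-Reasoning
  L₁ = subsetsOfSize n (suc m)
  L₀ = subsetsOfSize n m
  inside⊈outside : ∀ q → ¬ (inside ∷ q) ⊆ (outside ∷ p)
  inside⊈outside q q⊆p with q⊆p Vec.here
  ... | ()

length-subsetsOfSize : ∀ n m → length (subsetsOfSize n m) ≡ n C m
length-subsetsOfSize n m = begin
  length (subsetsOfSize n m)
    ≡⟨ cong length (filter-all (_⊆? ⊤) (All.universal (λ q {x} → ⊆⊤ {p = q} {x}) (subsetsOfSize n m))) ⟨
  count (_⊆? ⊤ {n}) (subsetsOfSize n m)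
    ≡⟨ count-⊆-subsetsOfSize (⊤ {n}) m ⟩
  ∣ ⊤ {n} ∣ C m
    ≡⟨ cong (_C m) (∣⊤∣≡n n) ⟩
  n C m
    ∎
  where open ≡-Reasoning

2*∣p∩q∣+∣p△q∣≡∣p∣+∣q∣ : (p q : Subset n) → 2 * ∣ p ∩ q ∣ + ∣ p △ q ∣ ≡ ∣ p ∣ + ∣ q ∣
2*∣p∩q∣+∣p△q∣≡∣p∣+∣q∣ []            []            = refl
2*∣p∩q∣+∣p△q∣≡∣p∣+∣q∣ (outside ∷ p) (outside ∷ q) = 2*∣p∩q∣+∣p△q∣≡∣p∣+∣q∣ p q
2*∣p∩q∣+∣p△q∣≡∣p∣+∣q∣ (inside  ∷ p) (inside  ∷ q) = begin
  2 * suc ∣ p ∩ q ∣ + ∣ p △ q ∣     ≡⟨ cong (_+ ∣ p △ q ∣) (*-suc 2 ∣ p ∩ q ∣) ⟩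
  2 + (2 * ∣ p ∩ q ∣ + ∣ p △ q ∣)   ≡⟨ cong (2 +_) (2*∣p∩q∣+∣p△q∣≡∣p∣+∣q∣ p q) ⟩
  2 + (∣ p ∣ + ∣ q ∣)               ≡⟨ cong suc (+-suc ∣ p ∣ ∣ q ∣) ⟨
  suc ∣ p ∣ + suc ∣ q ∣             ∎
  where open ≡-Reasoning
2*∣p∩q∣+∣p△q∣≡∣p∣+∣q∣ (inside  ∷ p) (outside ∷ q) =
  trans (+-suc (2 * ∣ p ∩ q ∣) ∣ p △ q ∣) (cong suc (2*∣p∩q∣+∣p△q∣≡∣p∣+∣q∣ p q))
2*∣p∩q∣+∣p△q∣≡∣p∣+∣q∣ (outside ∷ p) (inside  ∷ q) =
  trans (+-suc (2 * ∣ p ∩ q ∣) ∣ p △ q ∣)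
        (trans (cong suc (2*∣p∩q∣+∣p△q∣≡∣p∣+∣q∣ p q)) (sym (+-suc ∣ p ∣ ∣ q ∣)))

∣p△q∣≡0⇒p≡q : (p q : Subset n) → ∣ p △ q ∣ ≡ 0 → p ≡ q
∣p△q∣≡0⇒p≡q []            []            _ = refl
∣p△q∣≡0⇒p≡q (outside ∷ p) (outside ∷ q) h = cong (outside ∷_) (∣p△q∣≡0⇒p≡q p q h)
∣p△q∣≡0⇒p≡q (inside  ∷ p) (inside  ∷ q) h = cong (inside ∷_) (∣p△q∣≡0⇒p≡q p q h)

∣p∣≡0⇒p≡⊥ : (p : Subset n) → ∣ p ∣ ≡ 0 → p ≡ ⊥
∣p∣≡0⇒p≡⊥ []            _ = refl
∣p∣≡0⇒p≡⊥ (outside ∷ p) h = cong (outside ∷_) (∣p∣≡0⇒p≡⊥ p h)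

∣p∣≡1⇒p≡⁅x⁆ : (p : Subset n) → ∣ p ∣ ≡ 1 → ∃[ x ] p ≡ ⁅ x ⁆
∣p∣≡1⇒p≡⁅x⁆ (inside  ∷ p) h = zero , cong (inside ∷_) (∣p∣≡0⇒p≡⊥ p (suc-injective h))
∣p∣≡1⇒p≡⁅x⁆ (outside ∷ p) h with ∣p∣≡1⇒p≡⁅x⁆ p h
... | x , p≡⁅x⁆ = suc x , cong (outside ∷_) p≡⁅x⁆

-- Adjacency in T_k(K_n) unfolds to IsPair of the symmetric difference.
IsPair : Subset n → Set
IsPair p = ∃[ x ] ∃[ y ] (x ≢ y × p ≡ ⁅ x ⁆ ∪ ⁅ y ⁆)

IsPair⇔∣p∣≡2 : (p : Subset n) → IsPair p ⇔ ∣ p ∣ ≡ 2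
IsPair⇔∣p∣≡2 p = mk⇔ (λ { (x , y , x≢y , refl) → ∣⁅x⁆∪⁅y⁆∣≡2 x y x≢y }) (from p)
  where
  ∣⁅x⁆∪⁅y⁆∣≡2 : ∀ {n} (x y : Fin n) → x ≢ y → ∣ ⁅ x ⁆ ∪ ⁅ y ⁆ ∣ ≡ 2
  ∣⁅x⁆∪⁅y⁆∣≡2 zero    zero    x≢y = contradiction refl x≢y
  ∣⁅x⁆∪⁅y⁆∣≡2 zero    (suc y) _   = cong suc (trans (cong ∣_∣ (∪-identityˡ ⁅ y ⁆)) (∣⁅x⁆∣≡1 y))
  ∣⁅x⁆∪⁅y⁆∣≡2 (suc x) zero    _   = cong suc (trans (cong ∣_∣ (∪-identityʳ ⁅ x ⁆)) (∣⁅x⁆∣≡1 x))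
  ∣⁅x⁆∪⁅y⁆∣≡2 (suc x) (suc y) x≢y = ∣⁅x⁆∪⁅y⁆∣≡2 x y (x≢y ∘ cong suc)
  from : ∀ {n} (p : Subset n) → ∣ p ∣ ≡ 2 → IsPair p
  from (outside ∷ p) h with from p h
  ... | x , y , x≢y , p≡ = suc x , suc y , x≢y ∘ Fin.suc-injective , cong (outside ∷_) p≡
  from (inside ∷ p) h with ∣p∣≡1⇒p≡⁅x⁆ p (suc-injective h)
  ... | y , p≡⁅y⁆ = zero , suc y , (λ ()) , cong (inside ∷_) (trans p≡⁅y⁆ (sym (∪-identityˡ ⁅ y ⁆)))

subsetOfSize : (p : Subset n) → m ≤ ∣ p ∣ → ∃[ q ] (q ⊆ p × ∣ q ∣ ≡ m)
subsetOfSize []                    z≤n         = [] , (λ ()) , refl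
subsetOfSize         (outside ∷ p) m≤∣p∣       with subsetOfSize p m≤∣p∣
... | q , q⊆p , ∣q∣≡m = outside ∷ q , out⊆ q⊆p , ∣q∣≡m
subsetOfSize {suc n} (inside  ∷ p) z≤n         = ⊥ , ⊥⊆ , ∣⊥∣≡0 (suc n)
subsetOfSize         (inside  ∷ p) (s≤s m≤∣p∣) with subsetOfSize p m≤∣p∣
... | q , q⊆p , ∣q∣≡m = inside ∷ q , in⊆in q⊆p , cong suc ∣q∣≡m

[1+n]Cn≡1+n : ∀ n → suc n C n ≡ suc n
[1+n]Cn≡1+n n = trans (nCk≡nC[n∸k] (n≤1+n n)) (trans (cong (suc n C_) (m+n∸n≡m 1 n)) (nC1≡n (suc n)))

Apart : ℕ → Subset n → Subset n → Set
Apart j p q = ∀ t → ∣ t ∣ ≡ j → ¬ (t ⊆ p × t ⊆ q)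

Apart-sym : {j : ℕ} {p q : Subset n} → Apart j p q → Apart j q p
Apart-sym apart t ∣t∣≡j = apart t ∣t∣≡j ∘ swap

¬Apart-refl : {j : ℕ} {p : Subset n} → ∣ p ∣ ≡ suc j → ¬ Apart j p p
¬Apart-refl {j = j} {p} ∣p∣≡1+j apart with subsetOfSize p (subst (j ≤_) (sym ∣p∣≡1+j) (n≤1+n j))
... | t , t⊆p , ∣t∣≡j = apart t ∣t∣≡j (t⊆p , t⊆p)

module _ {j : ℕ} {p q : Subset n} (∣p∣≡1+j : ∣ p ∣ ≡ suc j) (∣q∣≡1+j : ∣ q ∣ ≡ suc j) where

  private
    2*∣p∩q∣+∣p△q∣≡2*[1+j] : 2 * ∣ p ∩ q ∣ + ∣ p △ q ∣ ≡ 2 * suc j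
    2*∣p∩q∣+∣p△q∣≡2*[1+j] = begin
      2 * ∣ p ∩ q ∣ + ∣ p △ q ∣  ≡⟨ 2*∣p∩q∣+∣p△q∣≡∣p∣+∣q∣ p q ⟩
      ∣ p ∣ + ∣ q ∣              ≡⟨ cong₂ _+_ ∣p∣≡1+j ∣q∣≡1+j ⟩
      suc j + suc j              ≡⟨ cong (suc j +_) (+-identityʳ (suc j)) ⟨
      2 * suc j                  ∎
      where open ≡-Reasoning

    2*[1+j]≡2*j+2 : 2 * suc j ≡ 2 * j + 2
    2*[1+j]≡2*j+2 = trans (*-suc 2 j) (+-comm 2 (2 * j))

  ∣p△q∣≡2⇒∣p∩q∣≡j : ∣ p △ q ∣ ≡ 2 → ∣ p ∩ q ∣ ≡ j
  ∣p△q∣≡2⇒∣p∩q∣≡j ∣p△q∣≡2 = *-cancelˡ-≡ _ _ 2 (+-cancelʳ-≡ 2 _ _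
    (trans (subst (λ d → 2 * ∣ p ∩ q ∣ + d ≡ 2 * suc j) ∣p△q∣≡2 2*∣p∩q∣+∣p△q∣≡2*[1+j]) 2*[1+j]≡2*j+2))

  common⇒≡⊎∣p△q∣≡2 : (t : Subset n) → ∣ t ∣ ≡ j → t ⊆ p → t ⊆ q → p ≡ q ⊎ ∣ p △ q ∣ ≡ 2
  common⇒≡⊎∣p△q∣≡2 t ∣t∣≡j t⊆p t⊆q with m≤n⇒m<n∨m≡n (subst (∣ p ∩ q ∣ ≤_) ∣p∣≡1+j (∣p∩q∣≤∣p∣ p q))
  ... | inj₁ ∣p∩q∣<1+j = inj₂ (+-cancelˡ-≡ (2 * j) _ _
    (trans (subst (λ i → 2 * i + ∣ p △ q ∣ ≡ 2 * suc j) ∣p∩q∣≡j 2*∣p∩q∣+∣p△q∣≡2*[1+j]) 2*[1+j]≡2*j+2))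
    where
    ∣p∩q∣≡j : ∣ p ∩ q ∣ ≡ j
    ∣p∩q∣≡j = ≤-antisym (m<1+n⇒m≤n ∣p∩q∣<1+j)
                        (subst (_≤ ∣ p ∩ q ∣) ∣t∣≡j (p⊆q⇒∣p∣≤∣q∣ (λ x∈t → x∈p∩q⁺ (t⊆p x∈t , t⊆q x∈t))))
  ... | inj₂ ∣p∩q∣≡1+j = inj₁ (∣p△q∣≡0⇒p≡q p q (+-cancelˡ-≡ (2 * suc j) _ 0
    (trans (subst (λ i → 2 * i + ∣ p △ q ∣ ≡ 2 * suc j) ∣p∩q∣≡1+j 2*∣p∩q∣+∣p△q∣≡2*[1+j])
           (sym (+-identityʳ (2 * suc j))))))

  ∣p△q∣≡2⇒¬Apart : ∣ p △ q ∣ ≡ 2 → ¬ Apart j p q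
  ∣p△q∣≡2⇒¬Apart ∣p△q∣≡2 apart = apart (p ∩ q) (∣p△q∣≡2⇒∣p∩q∣≡j ∣p△q∣≡2) (p∩q⊆p p q , p∩q⊆q p q)

IndependentPair : (Γ : Graph) → V Γ → V Γ → Set
IndependentPair Γ x y = x ≢ y × (¬ Adj Γ x y × ¬ Adj Γ y x)

IsIndependent⇔AllPairs : (Γ : Graph) (S : List (V Γ)) → IsIndependent Γ S ⇔ AllPairs (IndependentPair Γ) S
IsIndependent⇔AllPairs Γ S = mk⇔ AllPairs.zip AllPairs.unzip

Apart⇔IndependentPair : {j : ℕ} (x y : V (TokenGraph (suc j) (Kₙ n))) →
                        Apart j (proj₁ x) (proj₁ y) ⇔ IndependentPair (TokenGraph (suc j) (Kₙ n)) x y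
Apart⇔IndependentPair {n} {j} (p , ∣p∣) (q , ∣q∣) = mk⇔ to from
  where
  to : Apart j p q → IndependentPair (TokenGraph (suc j) (Kₙ n)) (p , ∣p∣) (q , ∣q∣)
  to apart = (λ { refl → ¬Apart-refl ∣p∣ apart })
           , (λ adj → ∣p△q∣≡2⇒¬Apart ∣p∣ ∣q∣ (Equivalence.to (IsPair⇔∣p∣≡2 (p △ q)) adj) apart)
           , (λ adj → ∣p△q∣≡2⇒¬Apart ∣q∣ ∣p∣ (Equivalence.to (IsPair⇔∣p∣≡2 (q △ p)) adj) (Apart-sym apart))
  from : IndependentPair (TokenGraph (suc j) (Kₙ n)) (p , ∣p∣) (q , ∣q∣) → Apart j p q
  from (distinct , nonadjacent , _) t ∣t∣≡j (t⊆p , t⊆q) with common⇒≡⊎∣p△q∣≡2 ∣p∣ ∣q∣ t ∣t∣≡j t⊆p t⊆q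
  ... | inj₁ refl    = distinct (cong (p ,_) (≡-irrelevant ∣p∣ ∣q∣))
  ... | inj₂ ∣p△q∣≡2 = nonadjacent (Equivalence.from (IsPair⇔∣p∣≡2 (p △ q)) ∣p△q∣≡2)

Packing : ℕ → List (Subset n) → Set
Packing j B = ∀ t → ∣ t ∣ ≡ j → count (t ⊆?_) B ≤ 1

Packing⇔AllPairs-Apart : {j : ℕ} (B : List (Subset n)) → Packing j B ⇔ AllPairs (Apart j) B
Packing⇔AllPairs-Apart B = mk⇔
  (λ packing → Equivalence.to (AllPairs-∀⇔ B) λ t ∣t∣≡j →
     Equivalence.to (count≤1⇔AllPairs (t ⊆?_) B) (packing t ∣t∣≡j))
  (λ apart t ∣t∣≡j →
     Equivalence.from (count≤1⇔AllPairs (t ⊆?_) B) (Equivalence.from (AllPairs-∀⇔ B) apart t ∣t∣≡j))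

IsIndependent⇔Packing : {j : ℕ} (S : List (V (TokenGraph (suc j) (Kₙ n)))) →
                        IsIndependent (TokenGraph (suc j) (Kₙ n)) S ⇔ Packing j (map proj₁ S)
IsIndependent⇔Packing {n} {j} S =
  ⇔-trans (IsIndependent⇔AllPairs (TokenGraph (suc j) (Kₙ n)) S)
  (⇔-trans (mk⇔ (AllPairs.map⁺ ∘ AllPairs.map (λ {x y} → Equivalence.from (Apart⇔IndependentPair x y)))
                (AllPairs.map (λ {x y} → Equivalence.to (Apart⇔IndependentPair x y)) ∘ AllPairs.map⁻))
           (⇔-sym (Packing⇔AllPairs-Apart (map proj₁ S))))

module _ {n j : ℕ} {B : List (Subset n)} (sized : All (λ b → ∣ b ∣ ≡ suc j) B) where

  private
    multiplicities : List ℕ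
    multiplicities = map (λ t → count (t ⊆?_) B) (subsetsOfSize n j)

    length-multiplicities : length multiplicities ≡ n C j
    length-multiplicities = trans (length-map _ (subsetsOfSize n j)) (length-subsetsOfSize n j)

    -- Each block contains (j+1) choose j = j+1 of the j-sets.
    sum-multiplicities : sum multiplicities ≡ suc j * length B
    sum-multiplicities = begin
      sum multiplicities
        ≡⟨ sum-count-comm _⊆?_ (subsetsOfSize n j) B ⟩
      sum (map (λ b → count (_⊆? b) (subsetsOfSize n j)) B)
        ≡⟨ cong sum (map-cong (λ b → count-⊆-subsetsOfSize b j) B) ⟩
      sum (map (λ b → ∣ b ∣ C j) B)
        ≡⟨ sum-map-const _ (All.map (λ ∣b∣≡1+j → trans (cong (_C j) ∣b∣≡1+j) ([1+n]Cn≡1+n j)) sized) ⟩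
      length B * suc j
        ≡⟨ *-comm (length B) (suc j) ⟩
      suc j * length B
        ∎
      where open ≡-Reasoning

    Packing⇒multiplicities≤1 : Packing j B → All (_≤ 1) multiplicities
    Packing⇒multiplicities≤1 packing = All-map⁺ (All.map (packing _) (subsetsOfSize-sized n j))

  Packing⇒bound : Packing j B → suc j * length B ≤ n C j
  Packing⇒bound packing =
    subst₂ _≤_ sum-multiplicities length-multiplicities (sum≤length (Packing⇒multiplicities≤1 packing))

  IsDesign⇔tight-Packing : IsDesign j n (suc j) 1 B ⇔ (Packing j B × suc j * length B ≡ n C j)
  IsDesign⇔tight-Packing = mk⇔ to from
    where
    to : IsDesign j n (suc j) 1 B → Packing j B × suc j * length B ≡ n C j
    to (_ , design) = packing , trans (sym sum-multiplicities) (trans sum≡length length-multiplicities)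
      where
      packing : Packing j B
      packing t ∣t∣≡j = ≤-reflexive (design t ∣t∣≡j)
      sum≡length : sum multiplicities ≡ length multiplicities
      sum≡length = Equivalence.from (sum≡length⇔All≡1 (Packing⇒multiplicities≤1 packing))
                     (All-map⁺ (All.map (design _) (subsetsOfSize-sized n j)))
    from : Packing j B × suc j * length B ≡ n C j → IsDesign j n (suc j) 1 B
    from (packing , tight) = sized , λ t ∣t∣≡j →
      All.lookup (All-map⁻ all≡1) (subst (λ m → t ∈ subsetsOfSize n m) ∣t∣≡j (∈-subsetsOfSize t))
      where
      all≡1 : All (_≡ 1) multiplicities
      all≡1 = Equivalence.to (sum≡length⇔All≡1 (Packing⇒multiplicities≤1 packing))
                (trans sum-multiplicities (trans tight (sym length-multiplicities)))

map-proj₁-toList : {P : A → Set} {xs : List A} (pxs : All P xs) → map proj₁ (All.toList pxs) ≡ xs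
map-proj₁-toList []         = refl
map-proj₁-toList (px ∷ pxs) = cong (_ ∷_) (map-proj₁-toList pxs)

theorem2p4 : (n k : ℕ) → 2 ≤ n → 1 ≤ k → k ≤ n / 2 →
    (a : ℕ) → IsIndependenceNumber (TokenGraph k (Kₙ n)) a →
    (k * a ≡ n C (k ∸ 1) ⇔ (∃[ B ] IsDesign (k ∸ 1) n k 1 B))
theorem2p4 n zero    _ () _ _ _
theorem2p4 n (suc j) _ _  _ a ((S , independent , |S|≡a) , maximal) = mk⇔ to from
  where
  packingS : Packing j (map proj₁ S)
  packingS = Equivalence.to (IsIndependent⇔Packing S) independent
  |S|≡a′ : length (map proj₁ S) ≡ a
  |S|≡a′ = trans (length-map proj₁ S) |S|≡a
  to : suc j * a ≡ n C j → ∃[ B ] IsDesign j n (suc j) 1 B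
  to tight = map proj₁ S , Equivalence.from (IsDesign⇔tight-Packing (All.fromList S))
                             (packingS , trans (cong (suc j *_) |S|≡a′) tight)
  from : ∃[ B ] IsDesign j n (suc j) 1 B → suc j * a ≡ n C j
  from (B , design@(sized , _)) with Equivalence.to (IsDesign⇔tight-Packing sized) design
  ... | packingB , tight = ≤-antisym
    (subst (λ m → suc j * m ≤ n C j) |S|≡a′ (Packing⇒bound (All.fromList S) packingS))
    (subst (_≤ suc j * a) tight (*-monoʳ-≤ (suc j) (subst (_≤ a) |T|≡|B| (maximal T independentT))))
    where
    T : List (V (TokenGraph (suc j) (Kₙ n)))
    T = All.toList sized
    independentT : IsIndependent (TokenGraph (suc j) (Kₙ n)) T
    independentT = Equivalence.from (IsIndependent⇔Packing T)
                     (subst (Packing j) (sym (map-proj₁-toList sized)) packingB)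
    |T|≡|B| : length T ≡ length B
    |T|≡|B| = trans (sym (length-map proj₁ T)) (cong length (map-proj₁-toList sized))
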